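{- Let $k\geq 2$ be an integer and let $D$ be a strongly connected digraph with no directed cycle of length congruent to $1$ modulo $k$. Let $T$ be a DFS tree of $D$ rooted at $r$, of length $t$, with generations $V_0,\ldots,V_t$. Then the sets $U_s=\bigcup_{0\le i\le t,\ i\equiv s\pmod{k}}V_i$, $s\in\{0,\ldots,k-1\}$, form a partition of $V(D)$ into acyclic sets.
   Context: All digraphs are finite and loopless. Strongly connected: directed path between any ordered pair of distinct vertices. A DFS tree $T$ of $D$ rooted at $r$ is the spanning out-branching produced by depth-first search on $D$ from $r$. $P_u$ is the unique directed path in $T$ from $r$ to $u$, $l(P_u)$ its number of arcs; the length of $T$ is $t=\max_u l(P_u)$, and the $i$-th generation is $V_i=\{u: l(P_u)=i\}$. A set of vertices is acyclic if it induces a subdigraph with no directed cycle. (As in the paper, "partition" allows some of the sets to be empty.) -}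

module Defs where

open import Data.Nat using (ℕ; zero; suc; _≤_; _%_; NonZero)
open import Data.Fin using (Fin; _≟_; toℕ)
open import Data.List.Relation.Unary.All using (All)
open import Data.Bool using (Bool; true; false; if_then_else_)
open import Data.Maybe using (Maybe; just; nothing)
open import Data.List using (List; []; _∷_; _++_; [_]; length)
open import Data.List.Relation.Unary.Unique.Propositional using (Unique)
open import Data.Unit using (⊤)
open import Data.Empty using (⊥)
open import Data.Product using (_×_; Σ; ∃; _,_)
open import Relation.Nullary using (¬_)
open import Relation.Nullary.Decidable using (⌊_⌋)
open import Relation.Binary.PropositionalEquality using (_≡_)
open import Relation.Binary.Construct.Closure.ReflexiveTransitive using (Star)

record Digraph (n : ℕ) : Set₁ where
  field
    Arc      : Fin n → Fin n → Set
    loopless : ∀ v → ¬ Arc v v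
open Digraph public

module _ {n : ℕ} (D : Digraph n) where

  IsWalk : List (Fin n) → Set
  IsWalk []           = ⊤
  IsWalk (x ∷ [])     = ⊤
  IsWalk (x ∷ y ∷ xs) = Arc D x y × IsWalk (y ∷ xs)

  Path : Fin n → Fin n → Set
  Path u v = Σ (List (Fin n)) λ mids →
    IsWalk (u ∷ mids ++ [ v ]) × Unique (u ∷ mids ++ [ v ])

  StronglyConnected : Set
  StronglyConnected = ∀ u v → ¬ u ≡ v → Path u v

  -- a directed cycle, given by its (distinct) vertices v₀ … v_{ℓ-1};
  -- arcs v_i → v_{i+1} and v_{ℓ-1} → v₀.  Its length is ℓ = length of the list.
  IsCycle : List (Fin n) → Set
  IsCycle []         = ⊥
  IsCycle (v₀ ∷ vs)  = IsWalk ((v₀ ∷ vs) ++ [ v₀ ]) × Unique (v₀ ∷ vs)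

  Acyclic : (Fin n → Set) → Set
  Acyclic S = ∀ (cs : List (Fin n)) → IsCycle cs → ¬ All S cs

  -- Depth-first search (nondeterministic: any unvisited out-neighbour of
  -- the top of the stack may be chosen).
  --   visited : which vertices have been discovered
  --   parent  : tree arcs found so far (parent v = just u means arc u → v in T)
  --   stack   : the current DFS path (top = head)

  record State : Set where
    constructor st
    field
      visited : Fin n → Bool
      parent  : Fin n → Maybe (Fin n)
      stack   : List (Fin n)

  update : {A : Set} → (Fin n → A) → Fin n → A → Fin n → A
  update f w a x = if ⌊ x ≟ w ⌋ then a else f x

  data Step : State → State → Set where
    push : ∀ {vis par u stk w} → Arc D u w → vis w ≡ false →
           Step (st vis par (u ∷ stk))
                (st (update vis w true) (update par w (just u)) (w ∷ u ∷ stk))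
    pop  : ∀ {vis par u stk} → (∀ w → Arc D u w → vis w ≡ true) →
           Step (st vis par (u ∷ stk)) (st vis par stk)

  initial : Fin n → State
  initial r = st (update (λ _ → false) r true) (λ _ → nothing) (r ∷ [])

  IsDFSTree : Fin n → (Fin n → Maybe (Fin n)) → Set
  IsDFSTree r par = ∃ λ vis → Star Step (initial r) (st vis par [])

-- Depth par r u d : the tree path P_u from r to u has length d (u ∈ V_d)
data Depth {n : ℕ} (par : Fin n → Maybe (Fin n)) (r : Fin n) : Fin n → ℕ → Set where
  root  : Depth par r r zero
  child : ∀ {u v d} → par v ≡ just u → Depth par r u d → Depth par r v (suc d)

TreeLength : {n : ℕ} → (Fin n → Maybe (Fin n)) → Fin n → ℕ → Set
TreeLength {n} par r t = (∀ u d → Depth par r u d → d ≤ t) × ∃ λ u → Depth par r u t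

U : {n : ℕ} → (Fin n → Maybe (Fin n)) → Fin n → ℕ → (k : ℕ) → .{{_ : NonZero k}} →
    Fin k → Fin n → Set
U par r t k s u = ∃ λ i → i ≤ t × i % k ≡ toℕ s × Depth par r u i

-- Let finish be the DFS post-order (the time each vertex is popped).  Every arc
-- f → w of D is either a back arc (w is a tree ancestor of f) or has finish w < finish f.
-- If w is an ancestor of f and both lie in U_s, their depths differ by a multiple of k,
-- so the back arc closes, together with the tree path from w to f, a cycle of length
-- ≡ 1 (mod k).  Hence arcs inside U_s strictly decrease the finishing time and U_s is
-- acyclic.  That the U_s partition V(D) is just the uniqueness of depths in the tree.
module Submission where

open import Defs
open import Data.Bool using (Bool; true; false)
open import Data.Empty using (⊥-elim)
open import Data.Fin using (Fin; toℕ; fromℕ<; _≟_)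
open import Data.Fin.Properties using (toℕ-injective; toℕ-fromℕ<)
open import Data.List using (List; []; _∷_; _++_; [_]; length)
import Data.List.Membership.DecPropositional as DecMembership
open import Data.List.Membership.Propositional using (_∈_; _∉_)
open import Data.List.Relation.Unary.All as All using (All; []; _∷_)
open import Data.List.Relation.Unary.AllPairs using ([]; _∷_)
open import Data.List.Relation.Unary.Any using (here; there)
open import Data.List.Relation.Unary.Linked as Linked using (Linked; [-]; _∷_)
open import Data.List.Relation.Unary.Unique.Propositional using (Unique)
open import Data.Maybe using (Maybe; just; nothing)
open import Data.Nat using (ℕ; suc; s≤s; _+_; _*_; _≤_; _<_; _%_; _/_; NonZero)
open import Data.Nat.DivMod using (m≡m%n+[m/n]*n; m%n<n; %-remove-+ʳ)
open import Data.Nat.Divisibility using (_∣_; divides; ∣m+n∣m⇒∣n; n∣m*n)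
open import Data.Nat.Properties
  using (+-assoc; +-identityʳ; +-suc; +-cancelˡ-≡; <-trans; <-irrefl; n<1+n; m<n⇒m<1+n; ≤-reflexive)
open import Data.Product as Product using (Σ; ∃; _×_; _,_; proj₁; proj₂)
open import Data.Sum as Sum using (_⊎_; inj₁; inj₂)
open import Data.Unit using (tt)
open import Function using (flip; _∘_; case_of_)
open import Relation.Binary.Construct.Closure.ReflexiveTransitive as Star using (Star; ε; _◅_; _◅◅_)
open import Relation.Binary.PropositionalEquality
  using (_≡_; _≢_; refl; sym; trans; cong; subst; subst₂; module ≡-Reasoning)
open import Relation.Nullary using (¬_; yes; no)

[m+n]%d≡m%d⇒d∣n : ∀ m n d .{{_ : NonZero d}} → (m + n) % d ≡ m % d → d ∣ n
[m+n]%d≡m%d⇒d∣n m n d eq = ∣m+n∣m⇒∣n (divides ((m + n) / d) m/d*d+n≡q*d) (n∣m*n (m / d))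
  where
  open ≡-Reasoning
  m/d*d+n≡q*d : m / d * d + n ≡ (m + n) / d * d
  m/d*d+n≡q*d = +-cancelˡ-≡ (m % d) _ _ (begin
    m % d + (m / d * d + n)        ≡⟨ +-assoc (m % d) _ n ⟨
    m % d + m / d * d + n          ≡⟨ cong (_+ n) (m≡m%n+[m/n]*n m d) ⟨
    m + n                          ≡⟨ m≡m%n+[m/n]*n (m + n) d ⟩
    (m + n) % d + (m + n) / d * d  ≡⟨ cong (_+ (m + n) / d * d) eq ⟩
    m % d + (m + n) / d * d        ∎)

module _ {n : ℕ} (D : Digraph n) (S : Fin n → Set) (rank : Fin n → ℕ)
         (rank-decreasing : ∀ {f w} → S f → S w → Arc D f w → rank w < rank f) where

  walk-rank-decreasing : ∀ x vs e → IsWalk D (x ∷ vs ++ [ e ]) → All S (x ∷ vs) → S e →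
                         rank e < rank x
  walk-rank-decreasing x []       e (x→e , _) (Sx ∷ []) Se = rank-decreasing Sx Se x→e
  walk-rank-decreasing x (y ∷ vs) e (x→y , walk) (Sx ∷ Svs) Se =
    <-trans (walk-rank-decreasing y vs e walk Svs Se) (rank-decreasing Sx (All.head Svs) x→y)

  rank-decreasing⇒Acyclic : Acyclic D S
  rank-decreasing⇒Acyclic (v ∷ vs) (walk , _) Svs =
    <-irrefl refl (walk-rank-decreasing v vs v walk Svs (All.head Svs))

module _ {n : ℕ} (par : Fin n → Maybe (Fin n)) where

  ParentOf : Fin n → Fin n → Set
  ParentOf x y = par y ≡ just x

  Ancestor : Fin n → Fin n → Set
  Ancestor = Star ParentOf

  -- the tree path from x to y is x ∷ pathTail a
  pathTail : ∀ {x y} → Ancestor x y → List (Fin n)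
  pathTail ε                 = []
  pathTail (_◅_ {j = z} _ a) = z ∷ pathTail a

module _ {n : ℕ} {par : Fin n → Maybe (Fin n)} {r : Fin n} where

  Depth-unique : par r ≡ nothing → ∀ {x d e} → Depth par r x d → Depth par r x e → d ≡ e
  Depth-unique root-parentless root       root       = refl
  Depth-unique root-parentless root       (child p _) with () ← trans (sym root-parentless) p
  Depth-unique root-parentless (child p _) root       with () ← trans (sym root-parentless) p
  Depth-unique root-parentless (child p dx) (child q dy) with refl ← trans (sym p) q =
    cong suc (Depth-unique root-parentless dx dy)

  Depth-pathTail : ∀ {x y d} → Depth par r x d → (a : Ancestor par x y) →
                   Depth par r y (d + length (pathTail par a))
  Depth-pathTail {d = d} dx ε = subst (Depth par r _) (sym (+-identityʳ d)) dx
  Depth-pathTail {d = d} dx (p ◅ a) =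
    subst (Depth par r _) (sym (+-suc d _)) (Depth-pathTail (child p dx) a)

  pathTail-deeper : ∀ {x y d} → Depth par r x d → (a : Ancestor par x y) →
                    All (λ v → ∃ λ e → d < e × Depth par r v e) (pathTail par a)
  pathTail-deeper dx ε = []
  pathTail-deeper {d = d} dx (p ◅ a) =
    (suc d , n<1+n d , child p dx) ∷
    All.map (λ (e , d<e , de) → e , <-trans (n<1+n d) d<e , de) (pathTail-deeper (child p dx) a)

  path-unique : par r ≡ nothing → ∀ {x y d} → Depth par r x d → (a : Ancestor par x y) →
                Unique (x ∷ pathTail par a)
  path-unique root-parentless dx ε = [] ∷ []
  path-unique root-parentless {x} {d = d} dx (p ◅ a) =
    All.map distinct (pathTail-deeper dx (p ◅ a)) ∷ path-unique root-parentless (child p dx) a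
    where
    distinct : ∀ {v} → ∃ (λ e → d < e × Depth par r v e) → x ≢ v
    distinct (e , d<e , dv) refl = <-irrefl (Depth-unique root-parentless dx dv) d<e

module _ {n : ℕ} {par : Fin n → Maybe (Fin n)} where

  Linked⇒Ancestor : ∀ {u x s} → Linked (flip (ParentOf par)) (u ∷ s) → x ∈ s → Ancestor par x u
  Linked⇒Ancestor (p ∷ _) (here refl)  = p ◅ ε
  Linked⇒Ancestor (p ∷ l) (there x∈s) = Linked⇒Ancestor l x∈s ◅◅ (p ◅ ε)

module _ {n : ℕ} (D : Digraph n) {par : Fin n → Maybe (Fin n)}
         (tree-arc : ∀ {x y} → ParentOf par x y → Arc D x y) where

  path-walk : ∀ {x y e} (a : Ancestor par x y) → Arc D y e → IsWalk D (x ∷ pathTail par a ++ [ e ])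
  path-walk ε       y→e = y→e , tt
  path-walk (p ◅ a) y→e = tree-arc p , path-walk a y→e

  module _ {r : Fin n} (root-parentless : par r ≡ nothing) where

    back-arc-cycle : ∀ {x y d} → Depth par r x d → (a : Ancestor par x y) → Arc D y x →
                     IsCycle D (x ∷ pathTail par a)
    back-arc-cycle dx a y→x = path-walk a y→x , path-unique root-parentless dx a

    no-back-arc-within-residue :
      (k : ℕ) .{{_ : NonZero k}} → (∀ cs → IsCycle D cs → length cs % k ≢ 1 % k) →
      ∀ {x y dx dy} → Depth par r x dx → Depth par r y dy → dy % k ≡ dx % k →
      (a : Ancestor par x y) → ¬ Arc D y x
    no-back-arc-within-residue k no-cycle {x} {dx = dx} Dx Dy dy≡dx a y→x =
      no-cycle (x ∷ pathTail par a) (back-arc-cycle Dx a y→x) (%-remove-+ʳ 1 k∣L)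
      where
      L = length (pathTail par a)
      k∣L : k ∣ L
      k∣L = [m+n]%d≡m%d⇒d∣n dx L k
              (trans (cong (_% k) (Depth-unique root-parentless (Depth-pathTail Dx a) Dy)) dy≡dx)

module _ {n : ℕ} (D : Digraph n) where

  update-≡ : ∀ {A : Set} (f : Fin n → A) w a → update D f w a w ≡ a
  update-≡ f w a with w ≟ w
  ... | yes _   = refl
  ... | no  w≢w = ⊥-elim (w≢w refl)

  update-≢ : ∀ {A : Set} (f : Fin n → A) {w a x} → x ≢ w → update D f w a x ≡ f x
  update-≢ f {w} {x = x} x≢w with x ≟ w
  ... | yes x≡w = ⊥-elim (x≢w x≡w)
  ... | no  _   = refl

  module Adopt {par : Fin n → Maybe (Fin n)} {w u : Fin n} (w-parentless : par w ≡ nothing) where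

    par′ : Fin n → Maybe (Fin n)
    par′ = update D par w (just u)

    ParentOf-adopt : ∀ {x y} → ParentOf par x y → ParentOf par′ x y
    ParentOf-adopt {x} {y} p = trans (update-≢ par y≢w) p
      where
      y≢w : y ≢ w
      y≢w refl with () ← trans (sym w-parentless) p

    Depth-adopt : ∀ {r x d} → Depth par r x d → Depth par′ r x d
    Depth-adopt root        = root
    Depth-adopt (child p d) = child (ParentOf-adopt p) (Depth-adopt d)

module DFS {n : ℕ} (D : Digraph n) (r : Fin n) where

  open DecMembership (_≟_ {n}) using (_∈?_)

  Finished : (Fin n → Bool) → List (Fin n) → Fin n → Set
  Finished vis stk x = vis x ≡ true × x ∉ stk

  -- finish x is the time at which x was popped; it is meaningful only for finished x.
  record Invariant (vis : Fin n → Bool) (par : Fin n → Maybe (Fin n)) (stk : List (Fin n))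
                   (finish : Fin n → ℕ) (clock : ℕ) : Set where
    field
      root-visited         : vis r ≡ true
      root-parentless      : par r ≡ nothing
      unvisited-parentless : ∀ {x} → vis x ≡ false → par x ≡ nothing
      tree-arc             : ∀ {x y} → ParentOf par x y → Arc D x y
      visited-depth        : ∀ {x} → vis x ≡ true → ∃ (Depth par r x)
      stack-visited        : ∀ {x} → x ∈ stk → vis x ≡ true
      stack-linked         : Linked (flip (ParentOf par)) stk
      finished-closed      : ∀ {f w} → Finished vis stk f → Arc D f w → vis w ≡ true
      finish-bound         : ∀ {x} → Finished vis stk x → finish x < clock
      finished-arc         : ∀ {f w} → Finished vis stk f → Arc D f w →
                             Ancestor par w f ⊎ (Finished vis stk w × finish w < finish f)
  open Invariant

  initially-visited⇒root : ∀ {x} → update D (λ _ → false) r true x ≡ true → x ≡ r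
  initially-visited⇒root {x} vx with x ≟ r
  ... | yes x≡r = x≡r
  ... | no  _   with () ← vx

  initial-invariant : Invariant (update D (λ _ → false) r true) (λ _ → nothing) [ r ] (λ _ → 0) 0
  initial-invariant = record
    { root-visited         = update-≡ D (λ _ → false) r true
    ; root-parentless      = refl
    ; unvisited-parentless = λ _ → refl
    ; tree-arc             = λ ()
    ; visited-depth        = λ vx → case initially-visited⇒root vx of λ { refl → 0 , root }
    ; stack-visited        = λ { (here refl) → update-≡ D (λ _ → false) r true }
    ; stack-linked         = [-]
    ; finished-closed      = ⊥-elim ∘ nothing-finished
    ; finish-bound         = ⊥-elim ∘ nothing-finished
    ; finished-arc         = ⊥-elim ∘ nothing-finished
    }
    where
    nothing-finished : ∀ {x} → ¬ Finished (update D (λ _ → false) r true) [ r ] x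
    nothing-finished (vx , x∉) = x∉ (here (initially-visited⇒root vx))

  push-invariant : ∀ {vis par u stk w finish clock} → Arc D u w → vis w ≡ false →
    Invariant vis par (u ∷ stk) finish clock →
    Invariant (update D vis w true) (update D par w (just u)) (w ∷ u ∷ stk) finish clock
  push-invariant {vis} {par} {u} {stk} {w} u→w w-unvisited I = record
    { root-visited         = visited-mono (root-visited I)
    ; root-parentless      = trans (update-≢ D par (fresh (root-visited I))) (root-parentless I)
    ; unvisited-parentless = unvisited-parentless′
    ; tree-arc             = tree-arc′
    ; visited-depth        = visited-depth′
    ; stack-visited        = λ { (here refl) → update-≡ D vis w true
                               ; (there x∈) → visited-mono (stack-visited I x∈) }
    ; stack-linked         = update-≡ D par w (just u) ∷ Linked.map ParentOf-adopt (stack-linked I)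
    ; finished-closed      = λ x-fin → visited-mono ∘ finished-closed I (finished-before x-fin)
    ; finish-bound         = finish-bound I ∘ finished-before
    ; finished-arc         = λ x-fin x→y → Sum.map (Star.map ParentOf-adopt) (Product.map₁ finished-after)
                                             (finished-arc I (finished-before x-fin) x→y)
    }
    where
    open Adopt D {par} {w} {u} (unvisited-parentless I w-unvisited)
    vis′ = update D vis w true

    fresh : ∀ {x} → vis x ≡ true → x ≢ w
    fresh vx refl with () ← trans (sym vx) w-unvisited

    visited-mono : ∀ {x} → vis x ≡ true → vis′ x ≡ true
    visited-mono vx = trans (update-≢ D vis (fresh vx)) vx

    finished-before : ∀ {x} → Finished vis′ (w ∷ u ∷ stk) x → Finished vis (u ∷ stk) x
    finished-before (vx , x∉) = trans (sym (update-≢ D vis (x∉ ∘ here))) vx , x∉ ∘ there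

    finished-after : ∀ {x} → Finished vis (u ∷ stk) x → Finished vis′ (w ∷ u ∷ stk) x
    finished-after (vx , x∉) = visited-mono vx , λ { (here x≡w) → fresh vx x≡w ; (there x∈) → x∉ x∈ }

    -- Matching on x ≟ w below also reduces every occurrence of update D _ w _ x.
    unvisited-parentless′ : ∀ {x} → vis′ x ≡ false → par′ x ≡ nothing
    unvisited-parentless′ {x} vx with x ≟ w
    ... | yes refl with () ← vx
    ... | no  _    = unvisited-parentless I vx

    tree-arc′ : ∀ {x y} → ParentOf par′ x y → Arc D x y
    tree-arc′ {y = y} p with y ≟ w
    ... | yes refl with refl ← p = u→w
    ... | no  _    = tree-arc I p

    visited-depth′ : ∀ {x} → vis′ x ≡ true → ∃ (Depth par′ r x)
    visited-depth′ {x} vx with x ≟ w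
    ... | yes refl = let d , du = visited-depth I (stack-visited I (here refl)) in
                     suc d , child (update-≡ D par w (just u)) (Depth-adopt du)
    ... | no  _    = Product.map₂ Depth-adopt (visited-depth I vx)

  pop-invariant : ∀ {vis par u stk finish clock} → (∀ w → Arc D u w → vis w ≡ true) →
    Invariant vis par (u ∷ stk) finish clock →
    Invariant vis par stk (update D finish u clock) (suc clock)
  pop-invariant {vis} {par} {u} {stk} {finish} {clock} u-explored I = record
    { root-visited         = root-visited I
    ; root-parentless      = root-parentless I
    ; unvisited-parentless = unvisited-parentless I
    ; tree-arc             = tree-arc I
    ; visited-depth        = visited-depth I
    ; stack-visited        = stack-visited I ∘ there
    ; stack-linked         = Linked.tail (stack-linked I)
    ; finished-closed      = finished-closed′
    ; finish-bound         = finish-bound′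
    ; finished-arc         = finished-arc′
    }
    where
    finish′ = update D finish u clock

    finished-now : ∀ {x} → Finished vis stk x → x ≡ u ⊎ Finished vis (u ∷ stk) x
    finished-now {x} (vx , x∉) with x ≟ u
    ... | yes x≡u = inj₁ x≡u
    ... | no  x≢u = inj₂ (vx , λ { (here x≡u) → x≢u x≡u ; (there x∈) → x∉ x∈ })

    finished-still : ∀ {x} → Finished vis (u ∷ stk) x → Finished vis stk x
    finished-still (vx , x∉) = vx , x∉ ∘ there

    finish-unchanged : ∀ {x} → Finished vis (u ∷ stk) x → finish′ x ≡ finish x
    finish-unchanged (_ , x∉) = update-≢ D finish (x∉ ∘ here)

    finish-last : ∀ {x} → Finished vis (u ∷ stk) x → finish′ x < finish′ u
    finish-last x-fin = subst₂ _<_ (sym (finish-unchanged x-fin)) (sym (update-≡ D finish u clock))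
                               (finish-bound I x-fin)

    explored-arc : ∀ {w} → Arc D u w → Ancestor par w u ⊎ (Finished vis stk w × finish′ w < finish′ u)
    explored-arc {w} u→w with w ∈? u ∷ stk
    ... | yes (here refl) = ⊥-elim (loopless D u u→w)
    ... | yes (there w∈)  = inj₁ (Linked⇒Ancestor (stack-linked I) w∈)
    ... | no  w∉          = inj₂ (finished-still w-fin , finish-last w-fin)
      where w-fin = u-explored w u→w , w∉

    finished-closed′ : ∀ {f w} → Finished vis stk f → Arc D f w → vis w ≡ true
    finished-closed′ f-fin f→w with finished-now f-fin
    ... | inj₁ refl  = u-explored _ f→w
    ... | inj₂ f-fin′ = finished-closed I f-fin′ f→w

    finish-bound′ : ∀ {x} → Finished vis stk x → finish′ x < suc clock
    finish-bound′ x-fin with finished-now x-fin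
    ... | inj₁ refl  = s≤s (≤-reflexive (update-≡ D finish u clock))
    ... | inj₂ x-fin′ =
      m<n⇒m<1+n (subst (_< clock) (sym (finish-unchanged x-fin′)) (finish-bound I x-fin′))

    finished-arc′ : ∀ {f w} → Finished vis stk f → Arc D f w →
                    Ancestor par w f ⊎ (Finished vis stk w × finish′ w < finish′ f)
    finished-arc′ f-fin f→w with finished-now f-fin
    ... | inj₁ refl  = explored-arc f→w
    ... | inj₂ f-fin′ with finished-arc I f-fin′ f→w
    ...   | inj₁ w≼f           = inj₁ w≼f
    ...   | inj₂ (w-fin , w<f) =
      inj₂ (finished-still w-fin , subst₂ _<_ (sym (finish-unchanged w-fin)) (sym (finish-unchanged f-fin′)) w<f)

  run-invariant : ∀ {vis par stk vis′ par′ stk′} →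
    Star (Step D) (st vis par stk) (st vis′ par′ stk′) →
    ∀ {finish clock} → Invariant vis par stk finish clock →
    ∃ λ finish′ → ∃ (Invariant vis′ par′ stk′ finish′)
  run-invariant ε                    I = _ , _ , I
  run-invariant (push u→w w-new ◅ run) I = run-invariant run (push-invariant u→w w-new I)
  run-invariant (pop u-explored ◅ run) I = run-invariant run (pop-invariant u-explored I)

  module Completed {vis par finish clock} (I : Invariant vis par [] finish clock)
                   (strongly-connected : StronglyConnected D) where

    walk-visited : ∀ x vs y → vis x ≡ true → IsWalk D (x ∷ vs ++ [ y ]) → vis y ≡ true
    walk-visited x []       y vx (x→y , _)    = finished-closed I (vx , λ ()) x→y
    walk-visited x (z ∷ vs) y vx (x→z , walk) =
      walk-visited z vs y (finished-closed I (vx , λ ()) x→z) walk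

    all-visited : ∀ x → vis x ≡ true
    all-visited x with x ≟ r
    ... | yes refl = root-visited I
    ... | no  x≢r  = let vs , walk , _ = strongly-connected r x (x≢r ∘ sym) in
                     walk-visited r vs x (root-visited I) walk

    depth : ∀ x → ∃ (Depth par r x)
    depth = visited-depth I ∘ all-visited

    arc-classification : ∀ {f w} → Arc D f w → Ancestor par w f ⊎ finish w < finish f
    arc-classification f→w = Sum.map₂ proj₂ (finished-arc I (all-visited _ , λ ()) f→w)

U-partition : ∀ {n} {par : Fin n → Maybe (Fin n)} {r : Fin n} (k : ℕ) .{{_ : NonZero k}} (t : ℕ) →
  par r ≡ nothing → (∀ u → ∃ (Depth par r u)) → (∀ u d → Depth par r u d → d ≤ t) →
  ∀ u → Σ (Fin k) λ s → U par r t k s u × (∀ s′ → U par r t k s′ u → s′ ≡ s)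
U-partition k t root-parentless depth bounded u =
  fromℕ< (m%n<n d k) , (d , bounded u d Du , sym (toℕ-fromℕ< (m%n<n d k)) , Du) , unique
  where
  d  = proj₁ (depth u)
  Du = proj₂ (depth u)
  unique : ∀ s′ → U _ _ t k s′ u → s′ ≡ fromℕ< (m%n<n d k)
  unique s′ (i , _ , i≡s′ , Di) = toℕ-injective (begin
    toℕ s′                 ≡⟨ i≡s′ ⟨
    i % k                  ≡⟨ cong (_% k) (Depth-unique root-parentless Di Du) ⟩
    d % k                  ≡⟨ toℕ-fromℕ< (m%n<n d k) ⟨
    toℕ (fromℕ< (m%n<n d k)) ∎)
    where open ≡-Reasoning

lemma5 : (k : ℕ) → .{{_ : NonZero k}} → 2 ≤ k →
    {n : ℕ} (D : Digraph n) → StronglyConnected D →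
    (∀ (cs : List (Fin n)) → IsCycle D cs → ¬ (length cs % k ≡ 1 % k)) →
    (r : Fin n) (par : Fin n → Maybe (Fin n)) → IsDFSTree D r par →
    (t : ℕ) → TreeLength par r t →
    (∀ (u : Fin n) → Σ (Fin k) λ s → U par r t k s u × (∀ s′ → U par r t k s′ u → s′ ≡ s))
    × (∀ (s : Fin k) → Acyclic D (U par r t k s))
lemma5 k _ D strongly-connected no-cycle r par (_ , dfs) t (bounded , _) =
  U-partition k t (root-parentless I) depth bounded ,
  λ s → rank-decreasing⇒Acyclic D (U par r t k s) finish finish-decreasing
  where
  open DFS D r
  open Invariant
  finish = proj₁ (run-invariant dfs initial-invariant)
  I      = proj₂ (proj₂ (run-invariant dfs initial-invariant))
  open Completed I strongly-connected

  finish-decreasing : ∀ {s f w} → U par r t k s f → U par r t k s w → Arc D f w → finish w < finish f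
  finish-decreasing (_ , _ , f≡s , Df) (_ , _ , w≡s , Dw) f→w with arc-classification f→w
  ... | inj₁ w≼f = ⊥-elim (no-back-arc-within-residue D (tree-arc I) (root-parentless I)
                             k no-cycle Dw Df (trans f≡s (sym w≡s)) w≼f f→w)
  ... | inj₂ w<f = w<f
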